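{- Let $n\ge 2$ be an even integer. Then (i) for $1\le k\le n-1$: $|E^{ - }_{\rm e}(n,k)|-|E^{ - }_{\rm o}(n,k)| = D_{n-1,k-1}$; (ii) for $0\le k\le n-2$: $|E^{+}_{\rm e}(n,k)|-|E^{+}_{\rm o}(n,k)| = -D_{n-1,k}$.
   Context: Permutations of $[m]=\{1,\dots,m\}$ are written as words $a_1a_2\cdots a_m$. An ascent is an index $i$ ($1\le i\le m-1$) with $a_i<a_{i+1}$. An inversion is a pair $(i,j)$ with $1\le i<j\le m$ and $a_i>a_j$. $E(m,k)$ is the set of permutations of $[m]$ with exactly $k$ ascents; $E_{\rm e}(m,k)$ and $E_{\rm o}(m,k)$ are its subsets of permutations with an even, respectively odd, number of inversions; $D_{m,k}=|E_{\rm e}(m,k)|-|E_{\rm o}(m,k)|$. $E_{\rm e}^{ - }(n,k)$, $E_{\rm o}^{ - }(n,k)$ denote the permutations $a_1\cdots a_n$ in $E_{\rm e}(n,k)$, respectively $E_{\rm o}(n,k)$, with $a_1<a_n$, and $E_{\rm e}^{+}(n,k)$, $E_{\rm o}^{+}(n,k)$ those with $a_1>a_n$. -}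

module Defs where

open import Data.Nat using (ℕ; zero; suc; _+_; _∸_; _<ᵇ_)
open import Data.Nat.Properties using (_≟_)
open import Data.Bool using (Bool; true; false; not; _∧_; if_then_else_)
open import Data.List using (List; []; _∷_; map; concatMap; filter; length; upTo; head; last; all)
open import Data.List.Relation.Unary.Unique.Propositional using (Unique)
open import Data.List.Relation.Unary.Unique.Propositional.Properties using ()
open import Data.Integer using (ℤ; +_; _-_)
open import Data.Maybe using (Maybe; just; nothing)
open import Relation.Nullary.Decidable using (does; ⌊_⌋)
open import Data.List.Membership.DecPropositional _≟_ using (_∈?_)

[_] : ℕ → List ℕ
[ m ] = map suc (upTo m)

words : List ℕ → ℕ → List (List ℕ)
words A zero = [] ∷ []
words A (suc l) = concatMap (λ a → map (a ∷_) (words A l)) A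

distinct : List ℕ → Bool
distinct [] = true
distinct (a ∷ w) = not ⌊ a ∈? w ⌋ ∧ distinct w

-- all permutations of [m], written as words a_1 ... a_m
-- (words of length m over [m] with pairwise distinct letters)
Perms : ℕ → List (List ℕ)
Perms m = filter (λ w → distinct w Data.Bool.≟ true) (words [ m ] m)

asc : List ℕ → ℕ
asc [] = 0
asc (a ∷ []) = 0
asc (a ∷ b ∷ w) = (if a <ᵇ b then 1 else 0) + asc (b ∷ w)

inv : List ℕ → ℕ
inv [] = 0
inv (a ∷ w) = length (filter (λ b → b Data.Nat.<? a) w) + inv w

even : ℕ → Bool
even zero = true
even (suc n) = not (even n)

count : (List ℕ → Bool) → List (List ℕ) → ℕ
count p xs = length (filter (λ w → p w Data.Bool.≟ true) xs)

signedCount : (List ℕ → Bool) → ℕ → ℕ → ℤ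
signedCount p m k =
  + count (λ w → p w ∧ ⌊ asc w ≟ k ⌋ ∧ even (inv w)) (Perms m)
  - + count (λ w → p w ∧ ⌊ asc w ≟ k ⌋ ∧ not (even (inv w))) (Perms m)

D : ℕ → ℕ → ℤ
D m k = signedCount (λ _ → true) m k

-- first letter less than last letter (a_1 < a_n); false on the empty word
firstLtLast : List ℕ → Bool
firstLtLast w with head w | last w
... | just a | just b = a <ᵇ b
... | _ | _ = false

firstGtLast : List ℕ → Bool
firstGtLast w with head w | last w
... | just a | just b = b <ᵇ a
... | _ | _ = false

Dminus : ℕ → ℕ → ℤ
Dminus n k = signedCount firstLtLast n k

Dplus : ℕ → ℕ → ℤ
Dplus n k = signedCount firstGtLast n k

module Submission where

-- Write n = m + 1 with m odd and sort the permutations of [n] by the position of the letter n.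
-- Appending n to a permutation u of [m] adds one ascent, no inversion and gives a₁ < aₙ;
-- prepending n keeps the ascents, adds m inversions and gives a₁ > aₙ.  These two families
-- contribute D_{n-1,k-1} to (i) and -D_{n-1,k} to (ii).  When n is an interior letter,
-- reversing the word and replacing every other letter v by n - v is an involution which keeps
-- the number of ascents and the comparison of a₁ with aₙ, but changes the parity of the number
-- of inversions, because exactly the m pairs containing n change status.  So the remaining
-- permutations cancel in pairs.

open import Defs
open import Data.Nat using (ℕ; zero; suc; _+_; _≤_; _<_; _∸_; _*_; z≤n; s≤s; _<ᵇ_)
import Data.Nat.Properties as ℕ
open import Data.Integer as ℤ using (ℤ; 0ℤ; 1ℤ; -1ℤ; -_)
import Data.Integer.Properties as ℤ
open import Data.Bool using (Bool; true; false; not; _∧_; _∨_; _xor_; if_then_else_)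
open import Data.Bool.Properties using (not-distribˡ-xor; not-injective; xor-same; xor-∧-commutativeRing)
open import Data.Maybe as Maybe using (just; nothing)
open import Data.Maybe.Properties using (just-injective; ≡-dec)
open import Data.List
  using (List; []; _∷_; _++_; _∷ʳ_; _ʳ++_; reverse; head; last; initLast; _∷ʳ′_; map; filter; foldr;
         length; upTo; concatMap; cartesianProductWith)
open import Data.List.Properties
  using (++-assoc; ∷-injective; ∷ʳ-injectiveˡ; map-∘; map-cong; map-id; length-map; length-upTo;
         length-++-sucʳ; unfold-reverse; reverse-map; reverse-involutive; head-map; last-map)
open import Data.List.Membership.Propositional using (_∈_)
open import Data.List.Membership.Propositional.Properties
  using (∈-map⁺; ∈-map⁻; ∈-upTo⁺; ∈-upTo⁻; ∈-filter⁺; ∈-filter⁻; ∈-∃++; ∈-++⁻; ∈-++⁺ˡ; ∈-++⁺ʳ;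
         ∈-cartesianProductWith⁺; ∈-cartesianProductWith⁻)
open import Data.List.Membership.Propositional.Properties.WithK using (unique∧set⇒bag)
open import Data.List.Membership.DecPropositional ℕ._≟_ using (_∈?_)
open import Data.List.Relation.Unary.Any using (here; there)
open import Data.List.Relation.Unary.All as All using (All; []; _∷_)
open import Data.List.Relation.Unary.All.Properties as All using (¬Any⇒All¬)
open import Data.List.Relation.Unary.AllPairs using ([]; _∷_)
open import Data.List.Relation.Unary.Unique.Propositional using (Unique)
import Data.List.Relation.Unary.Unique.Propositional.Properties as Unique
open import Data.List.Relation.Binary.BagAndSetEquality using (∼bag⇒↭)
open import Data.List.Relation.Binary.Permutation.Propositional using (_↭_; ↭-sym; ↭⇒↭ₛ)
open import Data.List.Relation.Binary.Permutation.Propositional.Properties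
  using (map⁺; All-resp-↭; ↭-length; ∷↭∷ʳ; ↭-reverse; shift)
import Data.List.Relation.Binary.Permutation.Setoid.Properties as PermutationSetoid
open import Data.Sum using (_⊎_; inj₁; inj₂)
open import Data.Product using (Σ; _×_; _,_; proj₁; proj₂; ∃-syntax; ∃₂)
open import Data.Empty using (⊥-elim)
open import Function using (id; _∘_; mk⇔; flip; _on_)
open import Relation.Nullary using (¬_; yes; no)
open import Relation.Nullary.Reflects using (det; ofʸ; ofⁿ; fromEquivalence)
open import Relation.Nullary.Decidable using (⌊_⌋; isYes≗does; dec-true; dec-false)
open import Relation.Unary using (Pred; Decidable)
open import Relation.Unary.Properties using (∁?)
open import Relation.Binary.PropositionalEquality
  using (_≡_; _≢_; refl; sym; trans; cong; cong₂; subst; setoid; module ≡-Reasoning)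
open import Algebra.Bundles using (CommutativeRing)
import Algebra.Properties.CommutativeSemigroup as CommutativeSemigroupProperties

private
  variable
    A B : Set

module ℕ+ = CommutativeSemigroupProperties ℕ.+-commutativeSemigroup
module ℤ+ = CommutativeSemigroupProperties ℤ.+-commutativeSemigroup
module Xor = CommutativeSemigroupProperties (CommutativeRing.+-commutativeSemigroup xor-∧-commutativeRing)

odd : ℕ → Bool
odd n = not (even n)

odd-+ : ∀ m n → odd (m + n) ≡ odd m xor odd n
odd-+ zero n = refl
odd-+ (suc m) n = trans (cong not (odd-+ m n)) (not-distribˡ-xor (odd m) (odd n))

odd-2* : ∀ h → odd (2 * h) ≡ false
odd-2* h = trans (odd-+ h (h + 0)) (trans (cong (λ t → odd h xor odd t) (ℕ.+-identityʳ h)) (xor-same (odd h)))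

bit : Bool → ℕ
bit b = if b then 1 else 0

odd-bit-+ : ∀ b n → odd (bit b + n) ≡ b xor odd n
odd-bit-+ true n = refl
odd-bit-+ false n = refl

<ᵇ-true : ∀ {a b} → a < b → (a <ᵇ b) ≡ true
<ᵇ-true {a} {b} a<b = det (ℕ.<ᵇ-reflects-< a b) (ofʸ a<b)

<ᵇ-false : ∀ {a b} → ¬ a < b → (a <ᵇ b) ≡ false
<ᵇ-false {a} {b} a≮b = det (ℕ.<ᵇ-reflects-< a b) (ofⁿ a≮b)

<ᵇ-cong : ∀ {a b c d} → (a < b → c < d) → (c < d → a < b) → (a <ᵇ b) ≡ (c <ᵇ d)
<ᵇ-cong {a} {b} {c} {d} to from =
  det (ℕ.<ᵇ-reflects-< a b) (fromEquivalence (from ∘ ℕ.<ᵇ⇒< c d) (ℕ.<⇒<ᵇ ∘ to))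

≟-self : ∀ n → ⌊ n ℕ.≟ n ⌋ ≡ true
≟-self n = trans (isYes≗does (n ℕ.≟ n)) (dec-true (n ℕ.≟ n) refl)

≟-other : ∀ {n b} → n ≢ b → ⌊ b ℕ.≟ n ⌋ ≡ false
≟-other {n} {b} n≢b = trans (isYes≗does (b ℕ.≟ n)) (dec-false (b ℕ.≟ n) (n≢b ∘ sym))

⌊suc≟suc⌋ : ∀ a k → ⌊ suc a ℕ.≟ suc k ⌋ ≡ ⌊ a ℕ.≟ k ⌋
⌊suc≟suc⌋ a k = trans (isYes≗does (suc a ℕ.≟ suc k)) (sym (isYes≗does (a ℕ.≟ k)))

∑ : (A → ℤ) → List A → ℤ
∑ f xs = foldr ℤ._+_ 0ℤ (map f xs)

∑-cong : ∀ {f g : A → ℤ} xs → (∀ {x} → x ∈ xs → f x ≡ g x) → ∑ f xs ≡ ∑ g xs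
∑-cong [] _ = refl
∑-cong (x ∷ xs) f≗g = cong₂ ℤ._+_ (f≗g (here refl)) (∑-cong xs (f≗g ∘ there))

∑-zero : ∀ {f : A → ℤ} xs → (∀ {x} → x ∈ xs → f x ≡ 0ℤ) → ∑ f xs ≡ 0ℤ
∑-zero {f} xs f≡0 = trans (∑-cong xs f≡0) (∑-0 xs)
  where
  ∑-0 : ∀ xs → ∑ (λ _ → 0ℤ) xs ≡ 0ℤ
  ∑-0 [] = refl
  ∑-0 (x ∷ xs) = trans (ℤ.+-identityˡ _) (∑-0 xs)

∑-map : ∀ (f : B → ℤ) (h : A → B) xs → ∑ f (map h xs) ≡ ∑ (f ∘ h) xs
∑-map f h xs = cong (foldr ℤ._+_ 0ℤ) (sym (map-∘ xs))

∑-neg : ∀ (f : A → ℤ) xs → ∑ (-_ ∘ f) xs ≡ - ∑ f xs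
∑-neg f [] = refl
∑-neg f (x ∷ xs) = trans (cong (λ s → - f x ℤ.+ s) (∑-neg f xs)) (sym (ℤ.neg-distrib-+ (f x) (∑ f xs)))

∑-partition : ∀ (f : A → ℤ) {ℓ} {P : Pred A ℓ} (P? : Decidable P) xs →
              ∑ f xs ≡ ∑ f (filter P? xs) ℤ.+ ∑ f (filter (∁? P?) xs)
∑-partition f P? [] = refl
∑-partition f P? (x ∷ xs) with P? x
... | yes _ = trans (cong (λ s → f x ℤ.+ s) (∑-partition f P? xs)) (sym (ℤ.+-assoc (f x) _ _))
... | no _  = trans (cong (λ s → f x ℤ.+ s) (∑-partition f P? xs))
                    (ℤ+.x∙yz≈y∙xz (f x) (∑ f (filter P? xs)) (∑ f (filter (∁? P?) xs)))

∑-↭ : ∀ (f : A → ℤ) {xs ys} → xs ↭ ys → ∑ f xs ≡ ∑ f ys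
∑-↭ f p = PermutationSetoid.foldr-commMonoid (setoid ℤ) ℤ.+-0-isCommutativeMonoid (↭⇒↭ₛ (map⁺ f p))

∑-bijection : ∀ (f : A → ℤ) (h : B → A) {xs ys} → Unique xs → Unique ys → (∀ {y z} → h y ≡ h z → y ≡ z) →
              (∀ {y} → y ∈ ys → h y ∈ xs) → (∀ {x} → x ∈ xs → ∃[ y ] y ∈ ys × x ≡ h y) →
              ∑ f xs ≡ ∑ (f ∘ h) ys
∑-bijection f h {xs} {ys} uxs uys h-injective into onto =
  trans (∑-↭ f (∼bag⇒↭ (unique∧set⇒bag uxs (Unique.map⁺ h-injective uys) (mk⇔ to from)))) (∑-map f h ys)
  where
  to : ∀ {x} → x ∈ xs → x ∈ map h ys
  to x∈ with onto x∈
  ... | y , y∈ , refl = ∈-map⁺ h y∈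
  from : ∀ {x} → x ∈ map h ys → x ∈ xs
  from x∈ with ∈-map⁻ h x∈
  ... | y , y∈ , refl = into y∈

∑-signReversingInvolution : ∀ (f : A → ℤ) (ι : A → A) {xs} → Unique xs → (∀ x → ι (ι x) ≡ x) →
                            (∀ {x} → x ∈ xs → ι x ∈ xs) → (∀ {x} → x ∈ xs → f (ι x) ≡ - f x) →
                            ∑ f xs ≡ 0ℤ
∑-signReversingInvolution f ι {xs} uxs ι-involutive closed reverses = self-negating (begin
  ∑ f xs         ≡⟨ ∑-bijection f ι uxs uxs ι-injective closed (λ {x} x∈ → ι x , closed x∈ , sym (ι-involutive x)) ⟩
  ∑ (f ∘ ι) xs   ≡⟨ ∑-cong xs reverses ⟩
  ∑ (-_ ∘ f) xs  ≡⟨ ∑-neg f xs ⟩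
  - ∑ f xs       ∎)
  where
  open ≡-Reasoning
  ι-injective : ∀ {x y} → ι x ≡ ι y → x ≡ y
  ι-injective {x} {y} eq = trans (sym (ι-involutive x)) (trans (cong ι eq) (ι-involutive y))
  self-negating : ∀ {i} → i ≡ - i → i ≡ 0ℤ
  self-negating {ℤ.+ zero} _ = refl

countᵇ : (A → Bool) → List A → ℕ
countᵇ p [] = 0
countᵇ p (x ∷ xs) = bit (p x) + countᵇ p xs

countAdjacentFrom : (A → A → Bool) → A → List A → ℕ
countAdjacentFrom r a [] = 0
countAdjacentFrom r a (b ∷ w) = bit (r a b) + countAdjacentFrom r b w

countAdjacent : (A → A → Bool) → List A → ℕ
countAdjacent r [] = 0
countAdjacent r (a ∷ w) = countAdjacentFrom r a w

countPairs : (A → A → Bool) → List A → ℕ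
countPairs r [] = 0
countPairs r (a ∷ w) = countᵇ (r a) w + countPairs r w

firstLast : (ℕ → ℕ → Bool) → List ℕ → Bool
firstLast r w = Maybe.fromMaybe false (Maybe.zipWith r (head w) (last w))

asc≡countAdjacent : ∀ w → asc w ≡ countAdjacent _<ᵇ_ w
asc≡countAdjacent [] = refl
asc≡countAdjacent (a ∷ []) = refl
asc≡countAdjacent (a ∷ b ∷ w) = cong (bit (a <ᵇ b) +_) (asc≡countAdjacent (b ∷ w))

inv≡countPairs : ∀ w → inv w ≡ countPairs (λ a b → b <ᵇ a) w
inv≡countPairs [] = refl
inv≡countPairs (a ∷ w) = cong₂ _+_ (smaller w) (inv≡countPairs w)
  where
  smaller : ∀ w → length (filter (λ b → b ℕ.<? a) w) ≡ countᵇ (λ b → b <ᵇ a) w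
  smaller [] = refl
  smaller (b ∷ w) with b <ᵇ a
  ... | true = cong suc (smaller w)
  ... | false = smaller w

firstLtLast≡firstLast : ∀ w → firstLtLast w ≡ firstLast _<ᵇ_ w
firstLtLast≡firstLast w with head w | last w
... | just _  | just _  = refl
... | just _  | nothing = refl
... | nothing | _       = refl

firstGtLast≡firstLast : ∀ w → firstGtLast w ≡ firstLast (flip _<ᵇ_) w
firstGtLast≡firstLast w with head w | last w
... | just _  | just _  = refl
... | just _  | nothing = refl
... | nothing | _       = refl

countᵇ-cong : ∀ {P : A → Set} {p q : A → Bool} {xs} → All P xs → (∀ {x} → P x → p x ≡ q x) →
              countᵇ p xs ≡ countᵇ q xs
countᵇ-cong [] _ = refl
countᵇ-cong (px ∷ pxs) p≗q = cong₂ _+_ (cong bit (p≗q px)) (countᵇ-cong pxs p≗q)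

countᵇ-false : ∀ (xs : List A) → countᵇ (λ _ → false) xs ≡ 0
countᵇ-false [] = refl
countᵇ-false (x ∷ xs) = countᵇ-false xs

countᵇ-true : ∀ (xs : List A) → countᵇ (λ _ → true) xs ≡ length xs
countᵇ-true [] = refl
countᵇ-true (x ∷ xs) = cong suc (countᵇ-true xs)

countᵇ-++ : ∀ (p : A → Bool) xs ys → countᵇ p (xs ++ ys) ≡ countᵇ p xs + countᵇ p ys
countᵇ-++ p [] ys = refl
countᵇ-++ p (x ∷ xs) ys = trans (cong (bit (p x) +_) (countᵇ-++ p xs ys)) (sym (ℕ.+-assoc (bit (p x)) _ _))

countᵇ-reverse : ∀ (p : A → Bool) xs → countᵇ p (reverse xs) ≡ countᵇ p xs
countᵇ-reverse p [] = refl
countᵇ-reverse p (x ∷ xs) = begin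
  countᵇ p (reverse (x ∷ xs))                ≡⟨ cong (countᵇ p) (unfold-reverse x xs) ⟩
  countᵇ p (reverse xs ∷ʳ x)                 ≡⟨ countᵇ-++ p (reverse xs) (x ∷ []) ⟩
  countᵇ p (reverse xs) + (bit (p x) + 0)    ≡⟨ cong₂ _+_ (countᵇ-reverse p xs) (ℕ.+-identityʳ (bit (p x))) ⟩
  countᵇ p xs + bit (p x)                    ≡⟨ ℕ.+-comm (countᵇ p xs) (bit (p x)) ⟩
  countᵇ p (x ∷ xs)                          ∎
  where open ≡-Reasoning

countᵇ-map : ∀ (p : B → Bool) (f : A → B) xs → countᵇ p (map f xs) ≡ countᵇ (p ∘ f) xs
countᵇ-map p f [] = refl
countᵇ-map p f (x ∷ xs) = cong (bit (p (f x)) +_) (countᵇ-map p f xs)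

odd-countᵇ-xor : ∀ (p q : A → Bool) xs →
                 odd (countᵇ (λ x → p x xor q x) xs) ≡ odd (countᵇ p xs) xor odd (countᵇ q xs)
odd-countᵇ-xor p q [] = refl
odd-countᵇ-xor p q (x ∷ xs) = begin
  odd (bit (p x xor q x) + countᵇ (λ y → p y xor q y) xs)       ≡⟨ odd-bit-+ (p x xor q x) _ ⟩
  (p x xor q x) xor odd (countᵇ (λ y → p y xor q y) xs)         ≡⟨ cong ((p x xor q x) xor_) (odd-countᵇ-xor p q xs) ⟩
  (p x xor q x) xor (odd (countᵇ p xs) xor odd (countᵇ q xs))   ≡⟨ Xor.interchange (p x) (q x) _ _ ⟩
  (p x xor odd (countᵇ p xs)) xor (q x xor odd (countᵇ q xs))   ≡⟨ sym (cong₂ _xor_ (odd-bit-+ (p x) _) (odd-bit-+ (q x) _)) ⟩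
  odd (countᵇ p (x ∷ xs)) xor odd (countᵇ q (x ∷ xs))           ∎
  where open ≡-Reasoning

countᵇ-≟-once : ∀ {n w} → Unique w → n ∈ w → countᵇ (λ b → ⌊ b ℕ.≟ n ⌋) w ≡ 1
countᵇ-≟-once {n} {_ ∷ w} (n≢w ∷ _) (here refl) rewrite ≟-self n =
  cong suc (trans (countᵇ-cong n≢w ≟-other) (countᵇ-false w))
countᵇ-≟-once {n} {x ∷ w} (x≢w ∷ uw) (there n∈w) rewrite ≟-other (All.lookup x≢w n∈w ∘ sym) =
  countᵇ-≟-once uw n∈w

countAdjacent-ʳ++ : ∀ (r : A → A → Bool) xs a acc →
                    countAdjacent r (xs ʳ++ a ∷ acc) ≡ countAdjacentFrom (flip r) a xs + countAdjacentFrom r a acc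
countAdjacent-ʳ++ r [] a acc = refl
countAdjacent-ʳ++ r (x ∷ xs) a acc =
  trans (countAdjacent-ʳ++ r xs x (a ∷ acc)) (ℕ+.x∙yz≈yx∙z (countAdjacentFrom (flip r) x xs) (bit (r x a)) _)

countAdjacent-reverse : ∀ (r : A → A → Bool) w → countAdjacent r (reverse w) ≡ countAdjacent (flip r) w
countAdjacent-reverse r [] = refl
countAdjacent-reverse r (a ∷ w) = trans (countAdjacent-ʳ++ r w a []) (ℕ.+-identityʳ _)

countAdjacent-map : ∀ (r : B → B → Bool) (f : A → B) w → countAdjacent r (map f w) ≡ countAdjacent (r on f) w
countAdjacent-map r f [] = refl
countAdjacent-map r f (a ∷ w) = from a w
  where
  from : ∀ a w → countAdjacentFrom r (f a) (map f w) ≡ countAdjacentFrom (r on f) a w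
  from a [] = refl
  from a (b ∷ w) = cong (bit (r (f a) (f b)) +_) (from b w)

countAdjacentFrom-cong : ∀ {P : A → Set} {r r′ : A → A → Bool} {a w} → P a → All P w →
                         (∀ {x y} → P x → P y → r x y ≡ r′ x y) →
                         countAdjacentFrom r a w ≡ countAdjacentFrom r′ a w
countAdjacentFrom-cong pa [] r≗r′ = refl
countAdjacentFrom-cong pa (pb ∷ pw) r≗r′ = cong₂ _+_ (cong bit (r≗r′ pa pb)) (countAdjacentFrom-cong pb pw r≗r′)

countAdjacent-cong : ∀ {P : A → Set} {r r′ : A → A → Bool} {w} → All P w →
                     (∀ {x y} → P x → P y → r x y ≡ r′ x y) → countAdjacent r w ≡ countAdjacent r′ w
countAdjacent-cong [] r≗r′ = refl
countAdjacent-cong (pa ∷ pw) r≗r′ = countAdjacentFrom-cong pa pw r≗r′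

countAdjacent-++ : ∀ (r : A → A → Bool) xs y ys →
                   countAdjacent r (xs ++ y ∷ ys) ≡ countAdjacent r (xs ∷ʳ y) + countAdjacentFrom r y ys
countAdjacent-++ r [] y ys = refl
countAdjacent-++ r (x ∷ xs) y ys = from x xs
  where
  from : ∀ x xs → countAdjacentFrom r x (xs ++ y ∷ ys) ≡ countAdjacentFrom r x (xs ∷ʳ y) + countAdjacentFrom r y ys
  from x [] = cong (_+ countAdjacentFrom r y ys) (sym (ℕ.+-identityʳ (bit (r x y))))
  from x (z ∷ xs) = trans (cong (bit (r x z) +_) (from z xs)) (sym (ℕ.+-assoc (bit (r x z)) _ _))

countPairs-∷ʳ : ∀ (r : A → A → Bool) xs y → countPairs r (xs ∷ʳ y) ≡ countPairs r xs + countᵇ (λ x → r x y) xs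
countPairs-∷ʳ r [] y = refl
countPairs-∷ʳ r (a ∷ xs) y = begin
  countᵇ (r a) (xs ∷ʳ y) + countPairs r (xs ∷ʳ y)
    ≡⟨ cong₂ _+_ (countᵇ-++ (r a) xs (y ∷ [])) (countPairs-∷ʳ r xs y) ⟩
  (countᵇ (r a) xs + (bit (r a y) + 0)) + (countPairs r xs + countᵇ (λ x → r x y) xs)
    ≡⟨ cong (λ t → (countᵇ (r a) xs + t) + _) (ℕ.+-identityʳ (bit (r a y))) ⟩
  (countᵇ (r a) xs + bit (r a y)) + (countPairs r xs + countᵇ (λ x → r x y) xs)
    ≡⟨ ℕ+.interchange (countᵇ (r a) xs) (bit (r a y)) _ _ ⟩
  countPairs r (a ∷ xs) + countᵇ (λ x → r x y) (a ∷ xs) ∎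
  where open ≡-Reasoning

countPairs-reverse : ∀ (r : A → A → Bool) w → countPairs r (reverse w) ≡ countPairs (flip r) w
countPairs-reverse r [] = refl
countPairs-reverse r (a ∷ w) = begin
  countPairs r (reverse (a ∷ w))                                ≡⟨ cong (countPairs r) (unfold-reverse a w) ⟩
  countPairs r (reverse w ∷ʳ a)                                 ≡⟨ countPairs-∷ʳ r (reverse w) a ⟩
  countPairs r (reverse w) + countᵇ (λ x → r x a) (reverse w)   ≡⟨ cong₂ _+_ (countPairs-reverse r w) (countᵇ-reverse _ w) ⟩
  countPairs (flip r) w + countᵇ (flip r a) w                   ≡⟨ ℕ.+-comm (countPairs (flip r) w) _ ⟩
  countPairs (flip r) (a ∷ w)                                   ∎
  where open ≡-Reasoning

countPairs-map : ∀ (r : B → B → Bool) (f : A → B) w → countPairs r (map f w) ≡ countPairs (r on f) w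
countPairs-map r f [] = refl
countPairs-map r f (a ∷ w) = cong₂ _+_ (countᵇ-map (r (f a)) f w) (countPairs-map r f w)

countPairs-cong : ∀ {P : A → Set} {r r′ : A → A → Bool} {w} → Unique w → All P w →
                  (∀ {x y} → P x → P y → x ≢ y → r x y ≡ r′ x y) → countPairs r w ≡ countPairs r′ w
countPairs-cong [] [] r≗r′ = refl
countPairs-cong (a≢w ∷ uw) (pa ∷ pw) r≗r′ =
  cong₂ _+_ (countᵇ-cong (All.zip (pw , a≢w)) (λ (pb , a≢b) → r≗r′ pa pb a≢b)) (countPairs-cong uw pw r≗r′)

odd-countPairs-xor : ∀ (r s : A → A → Bool) w →
                     odd (countPairs (λ x y → r x y xor s x y) w) ≡ odd (countPairs r w) xor odd (countPairs s w)
odd-countPairs-xor r s [] = refl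
odd-countPairs-xor r s (a ∷ w) = begin
  odd (countᵇ (λ y → r a y xor s a y) w + countPairs (λ x y → r x y xor s x y) w)
    ≡⟨ odd-+ (countᵇ (λ y → r a y xor s a y) w) _ ⟩
  odd (countᵇ (λ y → r a y xor s a y) w) xor odd (countPairs (λ x y → r x y xor s x y) w)
    ≡⟨ cong₂ _xor_ (odd-countᵇ-xor (r a) (s a) w) (odd-countPairs-xor r s w) ⟩
  (odd (countᵇ (r a) w) xor odd (countᵇ (s a) w)) xor (odd (countPairs r w) xor odd (countPairs s w))
    ≡⟨ Xor.interchange (odd (countᵇ (r a) w)) _ _ _ ⟩
  (odd (countᵇ (r a) w) xor odd (countPairs r w)) xor (odd (countᵇ (s a) w) xor odd (countPairs s w))
    ≡⟨ sym (cong₂ _xor_ (odd-+ (countᵇ (r a) w) _) (odd-+ (countᵇ (s a) w) _)) ⟩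
  odd (countPairs r (a ∷ w)) xor odd (countPairs s (a ∷ w)) ∎
  where open ≡-Reasoning

involves : ℕ → ℕ → ℕ → Bool
involves n a b = ⌊ a ℕ.≟ n ⌋ ∨ ⌊ b ℕ.≟ n ⌋

countPairs-involving : ∀ {n w} → Unique w → n ∈ w → suc (countPairs (involves n) w) ≡ length w
countPairs-involving {n} {_ ∷ w} (n≢w ∷ uw) (here refl) =
  cong suc (trans (cong₂ _+_ with-all (avoiding uw n≢w)) (ℕ.+-identityʳ (length w)))
  where
  with-all : countᵇ (involves n n) w ≡ length w
  with-all = trans (countᵇ-cong n≢w (λ {b} _ → cong (_∨ ⌊ b ℕ.≟ n ⌋) (≟-self n))) (countᵇ-true w)
  avoiding : ∀ {v} → Unique v → All (n ≢_) v → countPairs (involves n) v ≡ 0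
  avoiding [] [] = refl
  avoiding {a ∷ v} (_ ∷ uv) (n≢a ∷ n≢v) rewrite ≟-other n≢a =
    cong₂ _+_ (trans (countᵇ-cong n≢v ≟-other) (countᵇ-false v)) (avoiding uv n≢v)
countPairs-involving {n} {x ∷ w} (x≢w ∷ uw) (there n∈w) rewrite ≟-other (All.lookup x≢w n∈w ∘ sym) =
  cong suc (trans (cong (_+ countPairs (involves n) w) (countᵇ-≟-once uw n∈w)) (countPairs-involving uw n∈w))

head-ʳ++ : ∀ (xs : List A) y ys → head (xs ʳ++ y ∷ ys) ≡ last (y ∷ xs)
head-ʳ++ [] y ys = refl
head-ʳ++ (x ∷ xs) y ys = head-ʳ++ xs x (y ∷ ys)

last-ʳ++ : ∀ (xs : List A) y ys → last (xs ʳ++ y ∷ ys) ≡ last (y ∷ ys)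
last-ʳ++ [] y ys = refl
last-ʳ++ (x ∷ xs) y ys = last-ʳ++ xs x (y ∷ ys)

head-reverse : ∀ (xs : List A) → head (reverse xs) ≡ last xs
head-reverse [] = refl
head-reverse (x ∷ xs) = head-ʳ++ xs x []

last-reverse : ∀ (xs : List A) → last (reverse xs) ≡ head xs
last-reverse [] = refl
last-reverse (x ∷ xs) = last-ʳ++ xs x []

last-++ : ∀ (xs : List A) y ys → last (xs ++ y ∷ ys) ≡ last (y ∷ ys)
last-++ [] y ys = refl
last-++ (x ∷ []) y ys = refl
last-++ (x ∷ x′ ∷ xs) y ys = last-++ (x′ ∷ xs) y ys

last-∈ : ∀ (x : A) xs → ∃[ z ] last (x ∷ xs) ≡ just z × z ∈ x ∷ xs
last-∈ x [] = x , refl , here refl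
last-∈ x (y ∷ xs) with last-∈ y xs
... | z , last≡z , z∈ = z , last≡z , there z∈

firstLast-ends : ∀ r w {a z} → head w ≡ just a → last w ≡ just z → firstLast r w ≡ r a z
firstLast-ends r w head≡a last≡z rewrite head≡a | last≡z = refl

firstLast-map-reverse : ∀ r f w → firstLast r (map f (reverse w)) ≡ firstLast (λ a z → r (f z) (f a)) w
firstLast-map-reverse r f w
  rewrite head-map {f = f} (reverse w) | last-map f (reverse w) | head-reverse w | last-reverse w
  with head w | last w
... | just _  | just _  = refl
... | just _  | nothing = refl
... | nothing | just _  = refl
... | nothing | nothing = refl

-- Permutations of [m]

InRange : ℕ → ℕ → Set
InRange m a = 1 ≤ a × a ≤ m

record IsPerm (m : ℕ) (w : List ℕ) : Set where
  field
    unique  : Unique w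
    inRange : All (InRange m) w
    length≡ : length w ≡ m

open IsPerm

InRange-raise : ∀ {m a} → InRange m a → InRange (suc m) a
InRange-raise (1≤a , a≤m) = 1≤a , ℕ.m≤n⇒m≤1+n a≤m

InRange-lower : ∀ {m a} → InRange (suc m) a → suc m ≢ a → InRange m a
InRange-lower (1≤a , a≤) m≢a = 1≤a , ℕ.≤-pred (ℕ.≤∧≢⇒< a≤ (m≢a ∘ sym))

InRange-or-max : ∀ {m a} → InRange (suc m) a → InRange m a ⊎ a ≡ suc m
InRange-or-max (1≤a , a≤) with ℕ.m≤n⇒m<n∨m≡n a≤
... | inj₁ a<m = inj₁ (1≤a , ℕ.≤-pred a<m)
... | inj₂ a≡m = inj₂ a≡m

below⇒≢max : ∀ {m a} → InRange m a → suc m ≢ a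
below⇒≢max (_ , a≤m) refl = ℕ.1+n≰n a≤m

below<ᵇmax : ∀ {m a} → InRange m a → (a <ᵇ suc m) ≡ true
below<ᵇmax (_ , a≤m) = <ᵇ-true (s≤s a≤m)

max<ᵇbelow : ∀ {m a} → InRange m a → (suc m <ᵇ a) ≡ false
max<ᵇbelow (_ , a≤m) = <ᵇ-false (ℕ.≤⇒≯ (ℕ.m≤n⇒m≤1+n a≤m))

∈-[]⁺ : ∀ {m a} → InRange m a → a ∈ [ m ]
∈-[]⁺ {a = suc a} (_ , a≤m) = ∈-map⁺ suc (∈-upTo⁺ a≤m)

∈-[]⁻ : ∀ {m a} → a ∈ [ m ] → InRange m a
∈-[]⁻ a∈ with ∈-map⁻ suc a∈
... | i , i∈ , refl = s≤s z≤n , ∈-upTo⁻ i∈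

length-[] : ∀ m → length [ m ] ≡ m
length-[] m = trans (length-map suc (upTo m)) (length-upTo m)

words-suc : ∀ (A : List ℕ) l → words A (suc l) ≡ cartesianProductWith _∷_ A (words A l)
words-suc A l = prefixes A
  where
  prefixes : ∀ B → concatMap (λ b → map (b ∷_) (words A l)) B ≡ cartesianProductWith _∷_ B (words A l)
  prefixes [] = refl
  prefixes (b ∷ B) = cong (map (b ∷_) (words A l) ++_) (prefixes B)

∈-words⁻ : ∀ A l {w} → w ∈ words A l → length w ≡ l × All (_∈ A) w
∈-words⁻ A zero (here refl) = refl , []
∈-words⁻ A (suc l) w∈ rewrite words-suc A l with ∈-cartesianProductWith⁻ _∷_ A (words A l) w∈
... | a , v , a∈A , v∈ , refl with ∈-words⁻ A l v∈
... | |v|≡l , v⊆A = cong suc |v|≡l , a∈A ∷ v⊆A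

∈-words⁺ : ∀ A l {w} → length w ≡ l → All (_∈ A) w → w ∈ words A l
∈-words⁺ A zero {[]} refl [] = here refl
∈-words⁺ A (suc l) {a ∷ w} |w|≡ (a∈A ∷ w⊆A) rewrite words-suc A l =
  ∈-cartesianProductWith⁺ _∷_ a∈A (∈-words⁺ A l (ℕ.suc-injective |w|≡) w⊆A)

words-unique : ∀ {A} l → Unique A → Unique (words A l)
words-unique zero _ = [] ∷ []
words-unique {A} (suc l) uA rewrite words-suc A l =
  Unique.cartesianProductWith⁺ _∷_ ∷-injective uA (words-unique l uA)

distinct⇒unique : ∀ w → distinct w ≡ true → Unique w
distinct⇒unique [] _ = []
distinct⇒unique (a ∷ w) d with a ∈? w
... | no a∉w = ¬Any⇒All¬ w a∉w ∷ distinct⇒unique w d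

unique⇒distinct : ∀ {w} → Unique w → distinct w ≡ true
unique⇒distinct [] = refl
unique⇒distinct {a ∷ w} (a≢w ∷ uw) with a ∈? w
... | yes a∈w = ⊥-elim (All.lookup a≢w a∈w refl)
... | no _ = unique⇒distinct uw

∈-Perms⁻ : ∀ {m w} → w ∈ Perms m → IsPerm m w
∈-Perms⁻ {m} {w} w∈ with ∈-filter⁻ (λ v → distinct v Data.Bool.≟ true) {xs = words [ m ] m} w∈
... | w∈words , d with ∈-words⁻ [ m ] m w∈words
... | |w|≡m , w⊆[m] = record { unique = distinct⇒unique w d ; inRange = All.map ∈-[]⁻ w⊆[m] ; length≡ = |w|≡m }

∈-Perms⁺ : ∀ {m w} → IsPerm m w → w ∈ Perms m
∈-Perms⁺ {m} p = ∈-filter⁺ (λ v → distinct v Data.Bool.≟ true)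
  (∈-words⁺ [ m ] m (length≡ p) (All.map ∈-[]⁺ (inRange p))) (unique⇒distinct (unique p))

Perms-unique : ∀ m → Unique (Perms m)
Perms-unique m = Unique.filter⁺ (λ v → distinct v Data.Bool.≟ true)
  (words-unique m (Unique.map⁺ ℕ.suc-injective (Unique.upTo⁺ m)))

length-≤ : ∀ {xs ys : List A} → Unique xs → (∀ {x} → x ∈ xs → x ∈ ys) → length xs ≤ length ys
length-≤ {xs = []} _ _ = z≤n
length-≤ {xs = x ∷ xs} (x≢xs ∷ uxs) xs⊆ys with ∈-∃++ (xs⊆ys (here refl))
... | ys₁ , ys₂ , refl =
  subst (length (x ∷ xs) ≤_) (sym (length-++-sucʳ ys₁ x ys₂)) (s≤s (length-≤ uxs xs⊆ys₁++ys₂))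
  where
  xs⊆ys₁++ys₂ : ∀ {z} → z ∈ xs → z ∈ ys₁ ++ ys₂
  xs⊆ys₁++ys₂ z∈xs with ∈-++⁻ ys₁ (xs⊆ys (there z∈xs))
  ... | inj₁ z∈ys₁ = ∈-++⁺ˡ z∈ys₁
  ... | inj₂ (here refl) = ⊥-elim (All.lookup x≢xs z∈xs refl)
  ... | inj₂ (there z∈ys₂) = ∈-++⁺ʳ ys₁ z∈ys₂

max∈ : ∀ {m w} → IsPerm (suc m) w → suc m ∈ w
max∈ {m} {w} p with suc m ∈? w
... | yes m∈w = m∈w
... | no m∉w = ⊥-elim (ℕ.1+n≰n (subst (_≤ m) (length≡ p) (subst (length w ≤_) (length-[] m) w≤[m])))
  where
  w≤[m] : length w ≤ length [ m ]
  w≤[m] = length-≤ (unique p) λ x∈w → ∈-[]⁺ (InRange-lower (All.lookup (inRange p) x∈w) λ { refl → m∉w x∈w })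

¬IsPerm[] : ∀ {m} → 1 ≤ m → ¬ IsPerm m []
¬IsPerm[] 1≤m p with () ← subst (1 ≤_) (sym (length≡ p)) 1≤m

IsPerm-resp-↭ : ∀ {m v w} → v ↭ w → IsPerm m v → IsPerm m w
IsPerm-resp-↭ v↭w p = record
  { unique = PermutationSetoid.Unique-resp-↭ (setoid ℕ) (↭⇒↭ₛ v↭w) (unique p)
  ; inRange = All-resp-↭ v↭w (inRange p)
  ; length≡ = trans (sym (↭-length v↭w)) (length≡ p)
  }

max∷-IsPerm⁺ : ∀ {m u} → IsPerm m u → IsPerm (suc m) (suc m ∷ u)
max∷-IsPerm⁺ p = record
  { unique = All.map below⇒≢max (inRange p) ∷ unique p
  ; inRange = (s≤s z≤n , ℕ.≤-refl) ∷ All.map InRange-raise (inRange p)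
  ; length≡ = cong suc (length≡ p)
  }

max∷-IsPerm⁻ : ∀ {m u} → IsPerm (suc m) (suc m ∷ u) → IsPerm m u
max∷-IsPerm⁻ record { unique = m≢u ∷ uu ; inRange = _ ∷ u-range ; length≡ = |u|≡ } = record
  { unique = uu
  ; inRange = All.zipWith (λ (r , m≢a) → InRange-lower r m≢a) (u-range , m≢u)
  ; length≡ = ℕ.suc-injective |u|≡
  }

∷ʳmax-IsPerm⁺ : ∀ {m u} → IsPerm m u → IsPerm (suc m) (u ∷ʳ suc m)
∷ʳmax-IsPerm⁺ {m} {u} = IsPerm-resp-↭ (∷↭∷ʳ (suc m) u) ∘ max∷-IsPerm⁺

∷ʳmax-IsPerm⁻ : ∀ {m u} → IsPerm (suc m) (u ∷ʳ suc m) → IsPerm m u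
∷ʳmax-IsPerm⁻ {m} {u} = max∷-IsPerm⁻ ∘ IsPerm-resp-↭ (↭-sym (∷↭∷ʳ (suc m) u))

-- Reverse-complementing the letters below the maximum

-- v ↦ n ∸ v on 1 … n ∸ 1; it fixes 0 and every v ≥ n, so that it is an involution of ℕ.
compl : ℕ → ℕ → ℕ
compl n zero = zero
compl n (suc v) = if suc v <ᵇ n then n ∸ suc v else suc v

compl-below : ∀ {m v} → InRange m v → compl (suc m) v ≡ suc m ∸ v
compl-below {m} {suc v} r rewrite below<ᵇmax r = refl

compl-above : ∀ {n v} → n ≤ v → compl n v ≡ v
compl-above {v = zero} _ = refl
compl-above {n} {suc v} n≤v rewrite <ᵇ-false {suc v} {n} (ℕ.≤⇒≯ n≤v) = refl

compl-max : ∀ m → compl (suc m) (suc m) ≡ suc m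
compl-max m = compl-above ℕ.≤-refl

compl-InRange : ∀ {m v} → InRange m v → InRange m (compl (suc m) v)
compl-InRange {m} r@(1≤v , v≤m) rewrite compl-below r = ℕ.m<n⇒0<n∸m (s≤s v≤m) , ℕ.∸-monoʳ-≤ (suc m) 1≤v

compl-InRange-suc : ∀ {m v} → InRange (suc m) v → InRange (suc m) (compl (suc m) v)
compl-InRange-suc {m} r with InRange-or-max r
... | inj₁ r′ = InRange-raise (compl-InRange r′)
... | inj₂ refl = subst (InRange (suc m)) (sym (compl-max m)) r

compl-involutive : ∀ m v → compl (suc m) (compl (suc m) v) ≡ v
compl-involutive m zero = refl
compl-involutive m (suc v) with ℕ.≤-<-connex (suc v) m
... | inj₁ v≤m = begin
  compl (suc m) (compl (suc m) (suc v))  ≡⟨ cong (compl (suc m)) (compl-below r) ⟩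
  compl (suc m) (suc m ∸ suc v)          ≡⟨ compl-below (subst (InRange m) (compl-below r) (compl-InRange r)) ⟩
  suc m ∸ (suc m ∸ suc v)                ≡⟨ ℕ.m∸[m∸n]≡n (ℕ.m≤n⇒m≤1+n v≤m) ⟩
  suc v                                  ∎
  where
  open ≡-Reasoning
  r : InRange m (suc v)
  r = s≤s z≤n , v≤m
... | inj₂ m<v = trans (cong (compl (suc m)) (compl-above m<v)) (compl-above m<v)

compl-antitone : ∀ {m a b} → InRange m a → InRange m b → (compl (suc m) b <ᵇ compl (suc m) a) ≡ (a <ᵇ b)
compl-antitone ra rb rewrite compl-below ra | compl-below rb =
  <ᵇ-cong ℕ.∸-cancelʳ-< (λ a<b → ℕ.∸-monoʳ-< a<b (ℕ.m≤n⇒m≤1+n (proj₂ rb)))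

compl-xor : ∀ {m a b} → InRange (suc m) a → InRange (suc m) b → a ≢ b →
            (compl (suc m) a <ᵇ compl (suc m) b) ≡ involves (suc m) a b xor (b <ᵇ a)
compl-xor {m} ra rb a≢b with InRange-or-max ra | InRange-or-max rb
... | inj₂ refl | inj₂ refl = ⊥-elim (a≢b refl)
... | inj₁ ra′ | inj₁ rb′ rewrite ≟-other (below⇒≢max ra′) | ≟-other (below⇒≢max rb′) =
  compl-antitone rb′ ra′
... | inj₂ refl | inj₁ rb′ rewrite compl-max m | ≟-self (suc m) | below<ᵇmax rb′ =
  max<ᵇbelow (compl-InRange rb′)
... | inj₁ ra′ | inj₂ refl rewrite compl-max m | ≟-self (suc m) | ≟-other (below⇒≢max ra′) | max<ᵇbelow ra′ =
  below<ᵇmax (compl-InRange ra′)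

reverseCompl : ℕ → List ℕ → List ℕ
reverseCompl n w = map (compl n) (reverse w)

reverseCompl-involutive : ∀ m w → reverseCompl (suc m) (reverseCompl (suc m) w) ≡ w
reverseCompl-involutive m w = begin
  map φ (reverse (map φ (reverse w)))   ≡⟨ cong (map φ) (sym (reverse-map φ (reverse w))) ⟩
  map φ (map φ (reverse (reverse w)))   ≡⟨ sym (map-∘ (reverse (reverse w))) ⟩
  map (φ ∘ φ) (reverse (reverse w))     ≡⟨ map-cong (compl-involutive m) (reverse (reverse w)) ⟩
  map id (reverse (reverse w))          ≡⟨ map-id (reverse (reverse w)) ⟩
  reverse (reverse w)                   ≡⟨ reverse-involutive w ⟩
  w                                     ∎
  where
  open ≡-Reasoning
  φ = compl (suc m)

IsPerm-reverseCompl : ∀ {m w} → IsPerm (suc m) w → IsPerm (suc m) (reverseCompl (suc m) w)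
IsPerm-reverseCompl {m} {w} p = record
  { unique = Unique.map⁺ compl-injective (unique p′)
  ; inRange = All.map⁺ (All.map compl-InRange-suc (inRange p′))
  ; length≡ = trans (length-map (compl (suc m)) (reverse w)) (length≡ p′)
  }
  where
  p′ : IsPerm (suc m) (reverse w)
  p′ = IsPerm-resp-↭ (↭-sym (↭-reverse w)) p
  compl-injective : ∀ {a b} → compl (suc m) a ≡ compl (suc m) b → a ≡ b
  compl-injective {a} {b} eq =
    trans (sym (compl-involutive m a)) (trans (cong (compl (suc m)) eq) (compl-involutive m b))

-- Reversal and complement each flip every comparison between letters below the maximum, so
-- those pairs keep their status; the m pairs containing the maximum all change status.
odd-inv-reverseCompl : ∀ {m w} → IsPerm (suc m) w → odd (inv (reverseCompl (suc m) w)) ≡ odd m xor odd (inv w)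
odd-inv-reverseCompl {m} {w} p = begin
  odd (inv (map φ (reverse w)))
    ≡⟨ cong odd (inv≡countPairs (map φ (reverse w))) ⟩
  odd (countPairs (λ a b → b <ᵇ a) (map φ (reverse w)))
    ≡⟨ cong odd (countPairs-map (λ a b → b <ᵇ a) φ (reverse w)) ⟩
  odd (countPairs (λ a b → φ b <ᵇ φ a) (reverse w))
    ≡⟨ cong odd (countPairs-reverse (λ a b → φ b <ᵇ φ a) w) ⟩
  odd (countPairs (λ a b → φ a <ᵇ φ b) w)
    ≡⟨ cong odd (countPairs-cong (unique p) (inRange p) compl-xor) ⟩
  odd (countPairs (λ a b → involves (suc m) a b xor (b <ᵇ a)) w)
    ≡⟨ odd-countPairs-xor (involves (suc m)) (λ a b → b <ᵇ a) w ⟩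
  odd (countPairs (involves (suc m)) w) xor odd (countPairs (λ a b → b <ᵇ a) w)
    ≡⟨ cong₂ (λ i j → odd i xor odd j) pairs-with-max (sym (inv≡countPairs w)) ⟩
  odd m xor odd (inv w) ∎
  where
  open ≡-Reasoning
  φ = compl (suc m)
  pairs-with-max : countPairs (involves (suc m)) w ≡ m
  pairs-with-max = ℕ.suc-injective (trans (countPairs-involving (unique p) (max∈ p)) (length≡ p))

record MaxInterior (m : ℕ) (w : List ℕ) : Set where
  field
    isPerm   : IsPerm (suc m) w
    head≢max : head w ≢ just (suc m)
    last≢max : last w ≢ just (suc m)

open MaxInterior

data MaxSplit (m : ℕ) : List ℕ → Set where
  split : ∀ α a b β → IsPerm m (α ++ a ∷ b ∷ β) → MaxSplit m (α ++ a ∷ suc m ∷ b ∷ β)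

maxSplit : ∀ {m w} → MaxInterior m w → MaxSplit m w
maxSplit {m} i with ∈-∃++ (max∈ (isPerm i))
... | xs , ys , refl with initLast xs | ys
... | [] | _ = ⊥-elim (head≢max i refl)
... | α ∷ʳ′ a | [] = ⊥-elim (last≢max i (last-++ (α ∷ʳ a) (suc m) []))
... | α ∷ʳ′ a | b ∷ β = subst (MaxSplit m) (sym (++-assoc α (a ∷ []) (suc m ∷ b ∷ β))) (split α a b β p)
  where
  p : IsPerm m (α ++ a ∷ b ∷ β)
  p = subst (IsPerm m) (++-assoc α (a ∷ []) (b ∷ β))
        (max∷-IsPerm⁻ (IsPerm-resp-↭ (shift (suc m) (α ∷ʳ a) (b ∷ β)) (isPerm i)))

maxInterior-ends : ∀ {m w} → MaxInterior m w →
                   ∃₂ λ a z → head w ≡ just a × last w ≡ just z × InRange m a × InRange m z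
maxInterior-ends {m} {[]} i with () ← length≡ (isPerm i)
maxInterior-ends {m} {a ∷ w} i with last-∈ a w
... | z , last≡z , z∈ =
  a , z , refl , last≡z ,
  InRange-lower (All.lookup (inRange (isPerm i)) (here refl)) (λ { refl → head≢max i refl }) ,
  InRange-lower (All.lookup (inRange (isPerm i)) z∈) (λ { refl → last≢max i last≡z })

MaxInterior-reverseCompl : ∀ {m w} → MaxInterior m w → MaxInterior m (reverseCompl (suc m) w)
MaxInterior-reverseCompl {m} {w} i = record
  { isPerm = IsPerm-reverseCompl (isPerm i)
  ; head≢max = compl≢max (last≢max i) ∘ trans (sym head≡)
  ; last≢max = compl≢max (head≢max i) ∘ trans (sym last≡)
  }
  where
  head≡ : head (reverseCompl (suc m) w) ≡ Maybe.map (compl (suc m)) (last w)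
  head≡ = trans (head-map (reverse w)) (cong (Maybe.map _) (head-reverse w))
  last≡ : last (reverseCompl (suc m) w) ≡ Maybe.map (compl (suc m)) (head w)
  last≡ = trans (last-map (compl (suc m)) (reverse w)) (cong (Maybe.map _) (last-reverse w))
  compl≢max : ∀ {x} → x ≢ just (suc m) → Maybe.map (compl (suc m)) x ≢ just (suc m)
  compl≢max {just z} z≢max eq = z≢max (cong just (begin
    z                                 ≡⟨ sym (compl-involutive m z) ⟩
    compl (suc m) (compl (suc m) z)   ≡⟨ cong (compl (suc m)) (just-injective eq) ⟩
    compl (suc m) (suc m)             ≡⟨ compl-max m ⟩
    suc m                             ∎))
    where open ≡-Reasoning

firstLast-reverseCompl : ∀ {m w} (r : ℕ → ℕ → Bool) → MaxInterior m w →
                         (∀ {a z} → InRange m a → InRange m z → r (compl (suc m) z) (compl (suc m) a) ≡ r a z) →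
                         firstLast r (reverseCompl (suc m) w) ≡ firstLast r w
firstLast-reverseCompl {m} {w} r i r-compl with maxInterior-ends i
... | a , z , head≡a , last≡z , ra , rz = begin
  firstLast r (map φ (reverse w))        ≡⟨ firstLast-map-reverse r φ w ⟩
  firstLast (λ x y → r (φ y) (φ x)) w    ≡⟨ firstLast-ends _ w head≡a last≡z ⟩
  r (φ z) (φ a)                          ≡⟨ r-compl ra rz ⟩
  r a z                                  ≡⟨ sym (firstLast-ends r w head≡a last≡z) ⟩
  firstLast r w                          ∎
  where
  open ≡-Reasoning
  φ = compl (suc m)

firstLtLast-reverseCompl : ∀ {m w} → MaxInterior m w → firstLtLast (reverseCompl (suc m) w) ≡ firstLtLast w
firstLtLast-reverseCompl {m} {w} i = begin
  firstLtLast (reverseCompl (suc m) w)     ≡⟨ firstLtLast≡firstLast (reverseCompl (suc m) w) ⟩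
  firstLast _<ᵇ_ (reverseCompl (suc m) w)  ≡⟨ firstLast-reverseCompl _<ᵇ_ i compl-antitone ⟩
  firstLast _<ᵇ_ w                         ≡⟨ sym (firstLtLast≡firstLast w) ⟩
  firstLtLast w                            ∎
  where open ≡-Reasoning

firstGtLast-reverseCompl : ∀ {m w} → MaxInterior m w → firstGtLast (reverseCompl (suc m) w) ≡ firstGtLast w
firstGtLast-reverseCompl {m} {w} i = begin
  firstGtLast (reverseCompl (suc m) w)           ≡⟨ firstGtLast≡firstLast (reverseCompl (suc m) w) ⟩
  firstLast (flip _<ᵇ_) (reverseCompl (suc m) w) ≡⟨ firstLast-reverseCompl (flip _<ᵇ_) i (λ ra rz → compl-antitone rz ra) ⟩
  firstLast (flip _<ᵇ_) w                        ≡⟨ sym (firstGtLast≡firstLast w) ⟩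
  firstGtLast w                                  ∎
  where open ≡-Reasoning

-- The ascent into the maximum and the descent out of it trade places; every other adjacent
-- comparison is preserved.
asc-reverseCompl : ∀ {m w} → MaxInterior m w → asc (reverseCompl (suc m) w) ≡ asc w
asc-reverseCompl {m} i with maxSplit i
... | split α a b β p = begin
  asc (map φ (reverse w))                  ≡⟨ asc≡countAdjacent (map φ (reverse w)) ⟩
  countAdjacent _<ᵇ_ (map φ (reverse w))   ≡⟨ countAdjacent-map _<ᵇ_ φ (reverse w) ⟩
  countAdjacent (_<ᵇ_ on φ) (reverse w)    ≡⟨ countAdjacent-reverse (_<ᵇ_ on φ) w ⟩
  countAdjacent r′ w                       ≡⟨ countAdjacent-++ r′ α a (n ∷ b ∷ β) ⟩
  countAdjacent r′ (α ∷ʳ a) + (bit (r′ a n) + (bit (r′ n b) + countAdjacentFrom r′ b β))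
    ≡⟨ cong₂ _+_ (countAdjacent-cong rα∷ʳa compl-antitone) around-max ⟩
  countAdjacent _<ᵇ_ (α ∷ʳ a) + (bit (a <ᵇ n) + (bit (n <ᵇ b) + countAdjacentFrom _<ᵇ_ b β))
    ≡⟨ sym (countAdjacent-++ _<ᵇ_ α a (n ∷ b ∷ β)) ⟩
  countAdjacent _<ᵇ_ w                     ≡⟨ sym (asc≡countAdjacent w) ⟩
  asc w                                    ∎
  where
  open ≡-Reasoning
  n = suc m
  φ = compl n
  w = α ++ a ∷ n ∷ b ∷ β
  r′ : ℕ → ℕ → Bool
  r′ x y = φ y <ᵇ φ x
  ra∷b∷rβ = All.++⁻ʳ α (inRange p)
  ra = All.head ra∷b∷rβ
  rb = All.head (All.tail ra∷b∷rβ)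
  rα∷ʳa : All (InRange m) (α ∷ʳ a)
  rα∷ʳa = All.++⁺ (All.++⁻ˡ α (inRange p)) (ra ∷ [])
  around-max : bit (r′ a n) + (bit (r′ n b) + countAdjacentFrom r′ b β) ≡
               bit (a <ᵇ n) + (bit (n <ᵇ b) + countAdjacentFrom _<ᵇ_ b β)
  around-max rewrite compl-max m | max<ᵇbelow (compl-InRange ra) | below<ᵇmax (compl-InRange rb)
                   | below<ᵇmax ra | max<ᵇbelow rb =
    cong suc (countAdjacentFrom-cong rb (All.tail (All.tail ra∷b∷rβ)) compl-antitone)

sign : List ℕ → ℤ
sign w = if even (inv w) then 1ℤ else -1ℤ

signIf : (List ℕ → Bool) → List ℕ → ℤ
signIf c w = if c w then sign w else 0ℤ

counted : (List ℕ → Bool) → ℕ → List ℕ → Bool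
counted p k w = p w ∧ ⌊ asc w ℕ.≟ k ⌋

signedCount≡∑ : ∀ p m k → signedCount p m k ≡ ∑ (signIf (counted p k)) (Perms m)
signedCount≡∑ p m k = go (Perms m)
  where
  evens odds : List (List ℕ) → ℕ
  evens = count (λ w → p w ∧ ⌊ asc w ℕ.≟ k ⌋ ∧ even (inv w))
  odds = count (λ w → p w ∧ ⌊ asc w ℕ.≟ k ⌋ ∧ not (even (inv w)))
  go : ∀ ws → ℤ.+ evens ws ℤ.- ℤ.+ odds ws ≡ ∑ (signIf (counted p k)) ws
  go [] = refl
  go (w ∷ ws) with p w | ⌊ asc w ℕ.≟ k ⌋ | even (inv w)
  ... | false | _     | _     = trans (go ws) (sym (ℤ.+-identityˡ _))
  ... | true  | false | _     = trans (go ws) (sym (ℤ.+-identityˡ _))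
  ... | true  | true  | true  = trans (ℤ.+-assoc 1ℤ (ℤ.+ evens ws) (- ℤ.+ odds ws)) (cong (λ s → 1ℤ ℤ.+ s) (go ws))
  ... | true  | true  | false =
    trans (cong (λ s → ℤ.+ evens ws ℤ.+ s) (ℤ.neg-distrib-+ 1ℤ (ℤ.+ odds ws)))
          (trans (ℤ+.x∙yz≈y∙xz (ℤ.+ evens ws) -1ℤ (- ℤ.+ odds ws)) (cong (λ s → -1ℤ ℤ.+ s) (go ws)))

sign-flip : ∀ v w → odd (inv v) ≡ not (odd (inv w)) → sign v ≡ - sign w
sign-flip v w odd-flip with even (inv v) | even (inv w) | odd-flip
... | true  | false | _ = refl
... | false | true  | _ = refl

if-then-0-neg : ∀ {b b′ : Bool} {s s′ : ℤ} → b ≡ b′ → s ≡ - s′ → (if b then s else 0ℤ) ≡ - (if b′ then s′ else 0ℤ)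
if-then-0-neg {b′ = true} refl s≡-s′ = s≡-s′
if-then-0-neg {b′ = false} refl _ = refl

-- Splitting Perms (1 + m) by the position of the maximum

lastIsMax? : ∀ m → Decidable (λ (w : List ℕ) → last w ≡ just (suc m))
lastIsMax? m w = ≡-dec ℕ._≟_ (last w) (just (suc m))

headIsMax? : ∀ m → Decidable (λ (w : List ℕ) → head w ≡ just (suc m))
headIsMax? m w = ≡-dec ℕ._≟_ (head w) (just (suc m))

notEndingInMax : ℕ → List (List ℕ)
notEndingInMax m = filter (∁? (lastIsMax? m)) (Perms (suc m))

interiorPerms : ℕ → List (List ℕ)
interiorPerms m = filter (∁? (headIsMax? m)) (notEndingInMax m)

∈-interiorPerms⁻ : ∀ {m w} → w ∈ interiorPerms m → MaxInterior m w
∈-interiorPerms⁻ {m} w∈ with ∈-filter⁻ (∁? (headIsMax? m)) w∈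
... | w∈′ , head≢max with ∈-filter⁻ (∁? (lastIsMax? m)) w∈′
... | w∈P , last≢max = record { isPerm = ∈-Perms⁻ w∈P ; head≢max = head≢max ; last≢max = last≢max }

∈-interiorPerms⁺ : ∀ {m w} → MaxInterior m w → w ∈ interiorPerms m
∈-interiorPerms⁺ {m} i =
  ∈-filter⁺ (∁? (headIsMax? m)) (∈-filter⁺ (∁? (lastIsMax? m)) (∈-Perms⁺ (isPerm i)) (last≢max i)) (head≢max i)

∑-endingInMax : ∀ m (f : List ℕ → ℤ) →
                ∑ f (filter (lastIsMax? m) (Perms (suc m))) ≡ ∑ (f ∘ (_∷ʳ suc m)) (Perms m)
∑-endingInMax m f = ∑-bijection f (_∷ʳ suc m) (Unique.filter⁺ (lastIsMax? m) (Perms-unique (suc m)))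
  (Perms-unique m) (∷ʳ-injectiveˡ _ _) into onto
  where
  into : ∀ {u} → u ∈ Perms m → u ∷ʳ suc m ∈ filter (lastIsMax? m) (Perms (suc m))
  into {u} u∈ = ∈-filter⁺ (lastIsMax? m) (∈-Perms⁺ (∷ʳmax-IsPerm⁺ (∈-Perms⁻ u∈))) (last-++ u (suc m) [])
  onto : ∀ {w} → w ∈ filter (lastIsMax? m) (Perms (suc m)) → ∃[ u ] u ∈ Perms m × w ≡ u ∷ʳ suc m
  onto {w} w∈ with ∈-filter⁻ (lastIsMax? m) w∈
  ... | w∈P , last≡max with initLast w
  ... | [] with () ← last≡max
  ... | u ∷ʳ′ x with just-injective (trans (sym (last-++ u x [])) last≡max)
  ... | refl = u , ∈-Perms⁺ (∷ʳmax-IsPerm⁻ (∈-Perms⁻ w∈P)) , refl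

-- For m = 0 the single word [1] both starts and ends with the maximum.
∑-startingWithMax : ∀ {m} → 1 ≤ m → (f : List ℕ → ℤ) →
                    ∑ f (filter (headIsMax? m) (notEndingInMax m)) ≡ ∑ (f ∘ (suc m ∷_)) (Perms m)
∑-startingWithMax {m} 1≤m f = ∑-bijection f (suc m ∷_)
  (Unique.filter⁺ (headIsMax? m) (Unique.filter⁺ (∁? (lastIsMax? m)) (Perms-unique (suc m))))
  (Perms-unique m) (proj₂ ∘ ∷-injective) into onto
  where
  max∷-last≢max : ∀ {u} → IsPerm m u → last (suc m ∷ u) ≢ just (suc m)
  max∷-last≢max {[]} p = ⊥-elim (¬IsPerm[] 1≤m p)
  max∷-last≢max {a ∷ u} p last≡max with last-∈ a u
  ... | z , last≡z , z∈ =
    below⇒≢max (All.lookup (inRange p) z∈) (just-injective (trans (sym last≡max) last≡z))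
  into : ∀ {u} → u ∈ Perms m → suc m ∷ u ∈ filter (headIsMax? m) (notEndingInMax m)
  into u∈ = ∈-filter⁺ (headIsMax? m)
    (∈-filter⁺ (∁? (lastIsMax? m)) (∈-Perms⁺ (max∷-IsPerm⁺ (∈-Perms⁻ u∈))) (max∷-last≢max (∈-Perms⁻ u∈))) refl
  onto : ∀ {w} → w ∈ filter (headIsMax? m) (notEndingInMax m) → ∃[ u ] u ∈ Perms m × w ≡ suc m ∷ u
  onto {w} w∈ with ∈-filter⁻ (headIsMax? m) {xs = notEndingInMax m} w∈
  onto {x ∷ u} w∈ | w∈′ , refl =
    u , ∈-Perms⁺ (max∷-IsPerm⁻ (∈-Perms⁻ (proj₁ (∈-filter⁻ (∁? (lastIsMax? m)) {xs = Perms (suc m)} w∈′)))) , refl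

∑-Perms-suc : ∀ {m} → 1 ≤ m → (f : List ℕ → ℤ) →
              ∑ f (Perms (suc m)) ≡
              ∑ (f ∘ (_∷ʳ suc m)) (Perms m) ℤ.+ (∑ (f ∘ (suc m ∷_)) (Perms m) ℤ.+ ∑ f (interiorPerms m))
∑-Perms-suc {m} 1≤m f = begin
  ∑ f (Perms (suc m))
    ≡⟨ ∑-partition f (lastIsMax? m) (Perms (suc m)) ⟩
  ∑ f (filter (lastIsMax? m) (Perms (suc m))) ℤ.+ ∑ f (notEndingInMax m)
    ≡⟨ cong₂ ℤ._+_ (∑-endingInMax m f) (∑-partition f (headIsMax? m) (notEndingInMax m)) ⟩
  ∑ (f ∘ (_∷ʳ suc m)) (Perms m) ℤ.+ (∑ f (filter (headIsMax? m) (notEndingInMax m)) ℤ.+ ∑ f (interiorPerms m))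
    ≡⟨ cong (λ s → ∑ (f ∘ (_∷ʳ suc m)) (Perms m) ℤ.+ (s ℤ.+ ∑ f (interiorPerms m))) (∑-startingWithMax 1≤m f) ⟩
  ∑ (f ∘ (_∷ʳ suc m)) (Perms m) ℤ.+ (∑ (f ∘ (suc m ∷_)) (Perms m) ℤ.+ ∑ f (interiorPerms m)) ∎
  where open ≡-Reasoning

∑-interiorPerms : ∀ {m} → odd m ≡ true → (c : List ℕ → Bool) →
                  (∀ {w} → MaxInterior m w → c (reverseCompl (suc m) w) ≡ c w) →
                  ∑ (signIf c) (interiorPerms m) ≡ 0ℤ
∑-interiorPerms {m} odd-m c c-invariant =
  ∑-signReversingInvolution (signIf c) (reverseCompl (suc m))
    (Unique.filter⁺ (∁? (headIsMax? m)) (Unique.filter⁺ (∁? (lastIsMax? m)) (Perms-unique (suc m))))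
    (reverseCompl-involutive m) (∈-interiorPerms⁺ ∘ MaxInterior-reverseCompl ∘ ∈-interiorPerms⁻) reverses
  where
  reverses : ∀ {w} → w ∈ interiorPerms m → signIf c (reverseCompl (suc m) w) ≡ - signIf c w
  reverses {w} w∈ = if-then-0-neg (c-invariant i)
    (sign-flip (reverseCompl (suc m) w) w (trans (odd-inv-reverseCompl (isPerm i)) (cong (_xor odd (inv w)) odd-m)))
    where i = ∈-interiorPerms⁻ w∈

signedCount-suc : ∀ {m} → 1 ≤ m → odd m ≡ true → (p : List ℕ → Bool) →
                  (∀ {w} → MaxInterior m w → p (reverseCompl (suc m) w) ≡ p w) → ∀ k →
                  signedCount p (suc m) k ≡
                  ∑ (signIf (counted p k) ∘ (_∷ʳ suc m)) (Perms m) ℤ.+ ∑ (signIf (counted p k) ∘ (suc m ∷_)) (Perms m)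
signedCount-suc {m} 1≤m odd-m p p-invariant k = begin
  signedCount p (suc m) k                          ≡⟨ signedCount≡∑ p (suc m) k ⟩
  ∑ f (Perms (suc m))                              ≡⟨ ∑-Perms-suc 1≤m f ⟩
  endingInMax ℤ.+ (startingWithMax ℤ.+ ∑ f (interiorPerms m))
    ≡⟨ cong (λ s → endingInMax ℤ.+ (startingWithMax ℤ.+ s)) (∑-interiorPerms odd-m (counted p k) counted-invariant) ⟩
  endingInMax ℤ.+ (startingWithMax ℤ.+ 0ℤ)         ≡⟨ cong (λ s → endingInMax ℤ.+ s) (ℤ.+-identityʳ startingWithMax) ⟩
  endingInMax ℤ.+ startingWithMax                  ∎
  where
  open ≡-Reasoning
  f = signIf (counted p k)
  endingInMax = ∑ (f ∘ (_∷ʳ suc m)) (Perms m)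
  startingWithMax = ∑ (f ∘ (suc m ∷_)) (Perms m)
  counted-invariant : ∀ {w} → MaxInterior m w → counted p k (reverseCompl (suc m) w) ≡ counted p k w
  counted-invariant i = cong₂ _∧_ (p-invariant i) (cong (λ a → ⌊ a ℕ.≟ k ⌋) (asc-reverseCompl i))

asc-∷ʳmax : ∀ {m a u} → All (InRange m) (a ∷ u) → asc ((a ∷ u) ∷ʳ suc m) ≡ suc (asc (a ∷ u))
asc-∷ʳmax {u = []} (ra ∷ []) rewrite below<ᵇmax ra = refl
asc-∷ʳmax {a = a} {u = b ∷ u} (_ ∷ rbu) = trans (cong (bit (a <ᵇ b) +_) (asc-∷ʳmax rbu)) (ℕ.+-suc _ _)

asc-max∷ : ∀ {m u} → All (InRange m) u → asc (suc m ∷ u) ≡ asc u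
asc-max∷ [] = refl
asc-max∷ (rb ∷ _) rewrite max<ᵇbelow rb = refl

inv-∷ʳmax : ∀ {m u} → All (InRange m) u → inv (u ∷ʳ suc m) ≡ inv u
inv-∷ʳmax {m} {u} ru = begin
  inv (u ∷ʳ suc m)                                  ≡⟨ inv≡countPairs (u ∷ʳ suc m) ⟩
  countPairs R (u ∷ʳ suc m)                         ≡⟨ countPairs-∷ʳ R u (suc m) ⟩
  countPairs R u + countᵇ (suc m <ᵇ_) u             ≡⟨ cong (countPairs R u +_) none-above ⟩
  countPairs R u + 0                                ≡⟨ ℕ.+-identityʳ _ ⟩
  countPairs R u                                    ≡⟨ sym (inv≡countPairs u) ⟩
  inv u                                             ∎
  where
  open ≡-Reasoning
  R : ℕ → ℕ → Bool
  R a b = b <ᵇ a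
  none-above : countᵇ (suc m <ᵇ_) u ≡ 0
  none-above = trans (countᵇ-cong ru max<ᵇbelow) (countᵇ-false u)

inv-max∷ : ∀ {m u} → IsPerm m u → inv (suc m ∷ u) ≡ m + inv u
inv-max∷ {m} {u} p = begin
  inv (suc m ∷ u)                                           ≡⟨ inv≡countPairs (suc m ∷ u) ⟩
  countᵇ (_<ᵇ suc m) u + countPairs (λ a b → b <ᵇ a) u      ≡⟨ cong₂ _+_ all-below (sym (inv≡countPairs u)) ⟩
  m + inv u                                                 ∎
  where
  open ≡-Reasoning
  all-below : countᵇ (_<ᵇ suc m) u ≡ m
  all-below = trans (countᵇ-cong (inRange p) below<ᵇmax) (trans (countᵇ-true u) (length≡ p))

sign-∷ʳmax : ∀ {m u} → All (InRange m) u → sign (u ∷ʳ suc m) ≡ sign u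
sign-∷ʳmax ru = cong (λ i → if even i then 1ℤ else -1ℤ) (inv-∷ʳmax ru)

sign-max∷ : ∀ {m u} → odd m ≡ true → IsPerm m u → sign (suc m ∷ u) ≡ - sign u
sign-max∷ {m} {u} odd-m p =
  sign-flip (suc m ∷ u) u (trans (cong odd (inv-max∷ p)) (trans (odd-+ m (inv u)) (cong (_xor odd (inv u)) odd-m)))

firstLast-max∷ : ∀ r {m a u} → All (InRange m) (a ∷ u) → ∃[ z ] InRange m z × firstLast r (suc m ∷ a ∷ u) ≡ r (suc m) z
firstLast-max∷ r {m} {a} {u} rau with last-∈ a u
... | z , last≡z , z∈ = z , All.lookup rau z∈ , firstLast-ends r (suc m ∷ a ∷ u) refl last≡z

firstLtLast-∷ʳmax : ∀ {m a u} → InRange m a → firstLtLast ((a ∷ u) ∷ʳ suc m) ≡ true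
firstLtLast-∷ʳmax {m} {a} {u} ra = trans (firstLtLast≡firstLast ((a ∷ u) ∷ʳ suc m))
  (trans (firstLast-ends _<ᵇ_ ((a ∷ u) ∷ʳ suc m) refl (last-++ (a ∷ u) (suc m) [])) (below<ᵇmax ra))

firstGtLast-∷ʳmax : ∀ {m a u} → InRange m a → firstGtLast ((a ∷ u) ∷ʳ suc m) ≡ false
firstGtLast-∷ʳmax {m} {a} {u} ra = trans (firstGtLast≡firstLast ((a ∷ u) ∷ʳ suc m))
  (trans (firstLast-ends (flip _<ᵇ_) ((a ∷ u) ∷ʳ suc m) refl (last-++ (a ∷ u) (suc m) [])) (max<ᵇbelow ra))

firstLtLast-max∷ : ∀ {m a u} → All (InRange m) (a ∷ u) → firstLtLast (suc m ∷ a ∷ u) ≡ false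
firstLtLast-max∷ {m} {a} {u} rau with firstLast-max∷ _<ᵇ_ rau
... | z , rz , ends = trans (firstLtLast≡firstLast (suc m ∷ a ∷ u)) (trans ends (max<ᵇbelow rz))

firstGtLast-max∷ : ∀ {m a u} → All (InRange m) (a ∷ u) → firstGtLast (suc m ∷ a ∷ u) ≡ true
firstGtLast-max∷ {m} {a} {u} rau with firstLast-max∷ (flip _<ᵇ_) rau
... | z , rz , ends = trans (firstGtLast≡firstLast (suc m ∷ a ∷ u)) (trans ends (below<ᵇmax rz))

Dminus-suc : ∀ {m} → 1 ≤ m → odd m ≡ true → ∀ k → Dminus (suc m) (suc k) ≡ D m k
Dminus-suc {m} 1≤m odd-m k = begin
  Dminus (suc m) (suc k)
    ≡⟨ signedCount-suc 1≤m odd-m firstLtLast firstLtLast-reverseCompl (suc k) ⟩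
  ∑ (f ∘ (_∷ʳ suc m)) (Perms m) ℤ.+ ∑ (f ∘ (suc m ∷_)) (Perms m)
    ≡⟨ cong₂ ℤ._+_ (∑-cong (Perms m) (ending ∘ ∈-Perms⁻)) (∑-zero (Perms m) (starting ∘ ∈-Perms⁻)) ⟩
  ∑ (signIf (counted (λ _ → true) k)) (Perms m) ℤ.+ 0ℤ
    ≡⟨ ℤ.+-identityʳ _ ⟩
  ∑ (signIf (counted (λ _ → true) k)) (Perms m)
    ≡⟨ sym (signedCount≡∑ (λ _ → true) m k) ⟩
  D m k ∎
  where
  open ≡-Reasoning
  f = signIf (counted firstLtLast (suc k))
  ending : ∀ {u} → IsPerm m u → f (u ∷ʳ suc m) ≡ signIf (counted (λ _ → true) k) u
  ending {[]} p = ⊥-elim (¬IsPerm[] 1≤m p)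
  ending {a ∷ u} p = cong₂ (λ b s → if b then s else 0ℤ)
    (cong₂ _∧_ (firstLtLast-∷ʳmax {u = u} (All.head (inRange p)))
               (trans (cong (λ i → ⌊ i ℕ.≟ suc k ⌋) (asc-∷ʳmax (inRange p))) (⌊suc≟suc⌋ (asc (a ∷ u)) k)))
    (sign-∷ʳmax (inRange p))
  starting : ∀ {u} → IsPerm m u → f (suc m ∷ u) ≡ 0ℤ
  starting {[]} p = ⊥-elim (¬IsPerm[] 1≤m p)
  starting {a ∷ u} p =
    cong (λ b → if b ∧ ⌊ asc (suc m ∷ a ∷ u) ℕ.≟ suc k ⌋ then sign (suc m ∷ a ∷ u) else 0ℤ) (firstLtLast-max∷ (inRange p))

Dplus-suc : ∀ {m} → 1 ≤ m → odd m ≡ true → ∀ k → Dplus (suc m) k ≡ - D m k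
Dplus-suc {m} 1≤m odd-m k = begin
  Dplus (suc m) k
    ≡⟨ signedCount-suc 1≤m odd-m firstGtLast firstGtLast-reverseCompl k ⟩
  ∑ (f ∘ (_∷ʳ suc m)) (Perms m) ℤ.+ ∑ (f ∘ (suc m ∷_)) (Perms m)
    ≡⟨ cong₂ ℤ._+_ (∑-zero (Perms m) (ending ∘ ∈-Perms⁻)) (∑-cong (Perms m) (starting ∘ ∈-Perms⁻)) ⟩
  0ℤ ℤ.+ ∑ (-_ ∘ signIf (counted (λ _ → true) k)) (Perms m)
    ≡⟨ ℤ.+-identityˡ _ ⟩
  ∑ (-_ ∘ signIf (counted (λ _ → true) k)) (Perms m)
    ≡⟨ ∑-neg (signIf (counted (λ _ → true) k)) (Perms m) ⟩
  - ∑ (signIf (counted (λ _ → true) k)) (Perms m)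
    ≡⟨ cong -_ (sym (signedCount≡∑ (λ _ → true) m k)) ⟩
  - D m k ∎
  where
  open ≡-Reasoning
  f = signIf (counted firstGtLast k)
  ending : ∀ {u} → IsPerm m u → f (u ∷ʳ suc m) ≡ 0ℤ
  ending {[]} p = ⊥-elim (¬IsPerm[] 1≤m p)
  ending {a ∷ u} p =
    cong (λ b → if b ∧ ⌊ asc ((a ∷ u) ∷ʳ suc m) ℕ.≟ k ⌋ then sign ((a ∷ u) ∷ʳ suc m) else 0ℤ)
         (firstGtLast-∷ʳmax {u = u} (All.head (inRange p)))
  starting : ∀ {u} → IsPerm m u → f (suc m ∷ u) ≡ - signIf (counted (λ _ → true) k) u
  starting {[]} p = ⊥-elim (¬IsPerm[] 1≤m p)
  starting {a ∷ u} p = if-then-0-neg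
    (cong₂ _∧_ (firstGtLast-max∷ (inRange p)) (cong (λ i → ⌊ i ℕ.≟ k ⌋) (asc-max∷ (inRange p))))
    (sign-max∷ odd-m p)

corollary4p3 : (n : ℕ) → 2 ≤ n → Σ ℕ (λ h → n ≡ 2 * h) →
    ((k : ℕ) → 1 ≤ k → k ≤ n ∸ 1 → Dminus n k ≡ D (n ∸ 1) (k ∸ 1))
    × ((k : ℕ) → k ≤ n ∸ 2 → Dplus n k ≡ - D (n ∸ 1) k)
corollary4p3 (suc zero) (s≤s ()) _
corollary4p3 (suc (suc m)) _ (h , n≡2h) =
  (λ { (suc k) _ _ → Dminus-suc {suc m} (s≤s z≤n) odd-m k }) ,
  (λ k _ → Dplus-suc {suc m} (s≤s z≤n) odd-m k)
  where
  odd-m : odd (suc m) ≡ true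
  odd-m = trans (cong even n≡2h) (not-injective (odd-2* h))
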